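{- $X=\{x\in\mathrm{Cay}:\tilde\upsilon(\gamma(x))=\mathrm{sort}(x)\}$.
   Context: A Cayley permutation of length $n$ is a word $x=x(1)\cdots x(n)$ of positive integers in which every integer from $1$ to $\max(x)$ occurs; $\mathrm{Cay}$ is the set of all of them; $S$ is the set of permutations; $\mathrm{id}_n=12\cdots n$; $\mathrm{sort}(x)$ is the weakly increasing rearrangement of $x$. For a weakly increasing Cayley permutation $u$ and a Cayley permutation $v$ of the same length, the Burge transpose of the biword with columns $\binom{u(i)}{v(i)}$ is obtained by turning every column upside down and sorting the columns in increasing order of top entry, ties broken by decreasing bottom entry; write $(u,v)^T=(\mathrm{sort}(v),\Gamma(u,v))$, and let $\gamma(x)=\Gamma(\mathrm{id}_n,x)$. For $\pi\in S_n$ and $i\in[n]$ let $J(i)=0$ if $\pi(i)=1$ and otherwise let $J(i)$ be the index with $\pi(J(i))=\pi(i)-1$. The sites of $\pi$ are $0,1,\dots,n$ (site $0$ before $\pi(1)$, site $i\ge1$ immediately after $\pi(i)$). Site $0$ is $\eta$-active; site $i\ge1$ is $\eta$-active iff $J(i)<i$ or ($i<n$ and $\pi(i)<\pi(i+1)$). Let $\tilde\upsilon(\pi)(j)$ be the number of $\eta$-active sites among $0,\dots,j-1$. Define $\eta(\pi)=\Gamma(\tilde\upsilon(\pi),\pi)$ and $X=\eta(S)$. -}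

module Defs where

open import Data.Nat using (ℕ; zero; suc; _+_; _≤_; _∸_; _⊔_; _≤ᵇ_; _<ᵇ_; _≡ᵇ_)
open import Data.Bool using (Bool; true; false; _∨_; _∧_; if_then_else_)
open import Data.List using (List; []; _∷_; length; map; upTo; foldr; zipWith)
open import Data.List.Membership.Propositional using (_∈_)
open import Data.List.Relation.Unary.All using (All)
open import Data.List.Relation.Binary.Permutation.Propositional using (_↭_)
open import Data.Product using (_×_; _,_; proj₂)

-- Words are lists of naturals; positions are 1-based as in the paper.

idList : ℕ → List ℕ
idList n = map suc (upTo n)

maxL : List ℕ → ℕ
maxL = foldr _⊔_ 0

IsCay : List ℕ → Set
IsCay x = All (λ a → 1 ≤ a) x × (∀ k → 1 ≤ k → k ≤ maxL x → k ∈ x)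

IsPerm : List ℕ → Set
IsPerm π = π ↭ idList (length π)

insertℕ : ℕ → List ℕ → List ℕ
insertℕ a [] = a ∷ []
insertℕ a (b ∷ bs) = if a ≤ᵇ b then a ∷ b ∷ bs else b ∷ insertℕ a bs

sort : List ℕ → List ℕ
sort = foldr insertℕ []

-- columns (top , bottom); order: increasing top, ties by decreasing bottom
colLe : ℕ × ℕ → ℕ × ℕ → Bool
colLe (a , b) (c , d) = (a <ᵇ c) ∨ ((a ≡ᵇ c) ∧ (d ≤ᵇ b))

insertCol : ℕ × ℕ → List (ℕ × ℕ) → List (ℕ × ℕ)
insertCol p [] = p ∷ []
insertCol p (q ∷ qs) = if colLe p q then p ∷ q ∷ qs else q ∷ insertCol p qs

sortCols : List (ℕ × ℕ) → List (ℕ × ℕ)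
sortCols = foldr insertCol []

-- Burge transpose bottom row: Γ(u,v); columns (u(i),v(i)) flipped to (v(i),u(i)), sorted
Γ : List ℕ → List ℕ → List ℕ
Γ u v = map proj₂ (sortCols (zipWith (λ ui vi → (vi , ui)) u v))

γ : List ℕ → List ℕ
γ x = Γ (idList (length x)) x

-- nth π i = π(i) (1-based; 0 out of range)
nth : List ℕ → ℕ → ℕ
nth [] _ = 0
nth (a ∷ as) zero = 0
nth (a ∷ as) (suc zero) = a
nth (a ∷ as) (suc (suc k)) = nth as (suc k)

shiftPos : ℕ → ℕ
shiftPos zero = zero
shiftPos (suc k) = suc (suc k)

-- posOf v π = the (1-based) index i with π(i) = v, 0 if absent
posOf : ℕ → List ℕ → ℕ
posOf v [] = 0
posOf v (a ∷ as) = if a ≡ᵇ v then 1 else shiftPos (posOf v as)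

J : List ℕ → ℕ → ℕ
J π i = if nth π i ≡ᵇ 1 then 0 else posOf (nth π i ∸ 1) π

active : List ℕ → ℕ → Bool
active π zero = true
active π (suc i) =
  (J π (suc i) <ᵇ suc i) ∨ ((suc i <ᵇ length π) ∧ (nth π (suc i) <ᵇ nth π (suc (suc i))))

countActive : List ℕ → ℕ → ℕ
countActive π zero = 0
countActive π (suc j) = countActive π j + (if active π j then 1 else 0)

upsilonTilde : List ℕ → List ℕ
upsilonTilde π = map (countActive π) (idList (length π))

η : List ℕ → List ℕ
η π = Γ (upsilonTilde π) π

-- For a permutation π the word υ = υ̃(π) is weakly increasing with unit steps, starting at 1
-- because site 0 is active, and π descends at every inactive site. Hence the biword with
-- columns (υ(i), π(i)) is already sorted in Burge order, and Burge transposition is an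
-- involution on sorted biwords: transposing η(π) = Γ(υ, π) back gives γ(η π) = π. Since η π
-- is a rearrangement of υ, sort(η π) = υ, and η π is Cayley because υ is. Conversely, the
-- biword (id, x) is sorted for every word x, so the same involution gives
-- η(γ x) = Γ(sort x, γ x) = x as soon as υ̃(γ x) = sort x, and γ x is a permutation.
module Submission where

open import Defs
open import Algebra.Bundles using (CommutativeMonoid)
open import Data.Bool using (true; false; T; if_then_else_)
open import Data.Bool.Properties using (T-∨; T-∧)
open import Data.Empty using (⊥-elim)
open import Data.List using (List; []; _∷_; [_]; length; map; foldr; zip; applyUpTo)
open import Data.List.Properties
  using (map-∘; map-id; map-zipWith; map-applyUpTo; length-applyUpTo; foldr-preservesᵇ)
open import Data.List.Membership.Propositional using (_∈_)
open import Data.List.Membership.Propositional.Properties using (∈-applyUpTo⁺)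
open import Data.List.Relation.Binary.Equality.Propositional using (≋⇒≡)
open import Data.List.Relation.Binary.Permutation.Propositional
  using (_↭_; ↭-sym; ↭-trans; ↭-reflexive; ↭⇒↭ₛ; ↭⇒↭ₛ′; module PermutationReasoning)
open import Data.List.Relation.Binary.Permutation.Propositional.Properties
  using (map⁺; ↭-length; All-resp-↭; ∈-resp-↭)
open import Data.List.Relation.Binary.Permutation.Setoid.Properties using (foldr-commMonoid)
open import Data.List.Relation.Unary.All using (All)
import Data.List.Relation.Unary.All.Properties as All
import Data.List.Relation.Unary.Linked as Linked
import Data.List.Relation.Unary.Linked.Properties as Linked
open import Data.List.Relation.Unary.Sorted.TotalOrder.Properties using (↗↭↗⇒≋)
open import Data.Nat using (ℕ; zero; suc; _≤_; _<_; z≤n; s≤s; s≤s⁻¹; _≟_; _<?_; _≤?_)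
open import Data.Nat.Properties
open import Data.Product using (_×_; _,_; proj₁; proj₂; swap; ∃-syntax)
open import Data.Product.Properties using (≡-dec)
open import Data.Sum using (_⊎_; inj₁; inj₂)
open import Function using (_∘_; _⇔_; mk⇔; Equivalence)
open import Level using (0ℓ)
open import Relation.Binary using (Rel; IsDecTotalOrder; DecTotalOrder; Decidable; Total; Transitive; Antisymmetric; tri<; tri≈; tri>)
open import Relation.Binary.PropositionalEquality
  using (_≡_; refl; sym; trans; cong; cong₂; subst; isEquivalence; module ≡-Reasoning)
open import Relation.Nullary using (yes; no; does; _⊎-dec_; _×-dec_)

module FoldrInsertion
  {a ℓ} {A : Set a} {_≤_ : Rel A ℓ} (≤-isDecTotalOrder : IsDecTotalOrder _≡_ _≤_)
  (ins : A → List A → List A)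
  (ins-[] : ∀ x → ins x [] ≡ [ x ])
  (ins-∷ : ∀ x y ys → ins x (y ∷ ys) ≡
             (if does (IsDecTotalOrder._≤?_ ≤-isDecTotalOrder x y) then x ∷ y ∷ ys else y ∷ ins x ys))
  where

  private
    decTotalOrder : DecTotalOrder a a ℓ
    decTotalOrder = record { isDecTotalOrder = ≤-isDecTotalOrder }
    open DecTotalOrder decTotalOrder using (totalOrder) renaming (isEquivalence to ≡-isEquivalence; _≤?_ to _≤ₐ?_)

  open import Data.List.Sort.InsertionSort.Base decTotalOrder using (insert) renaming (sort to insertionSort)
  import Data.List.Sort.InsertionSort.Properties decTotalOrder as InsertionSort
  open import Data.List.Relation.Unary.Sorted.TotalOrder totalOrder public using (Sorted)

  ins≗insert : ∀ x ys → ins x ys ≡ insert x ys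
  ins≗insert x [] = ins-[] x
  ins≗insert x (y ∷ ys) = trans (ins-∷ x y ys)
    (cong (λ zs → if does (x ≤ₐ? y) then x ∷ y ∷ ys else y ∷ zs) (ins≗insert x ys))

  foldr-ins≗insertionSort : ∀ xs → foldr ins [] xs ≡ insertionSort xs
  foldr-ins≗insertionSort [] = refl
  foldr-ins≗insertionSort (x ∷ xs) =
    trans (ins≗insert x _) (cong (insert x) (foldr-ins≗insertionSort xs))

  sort-↭ : ∀ xs → foldr ins [] xs ↭ xs
  sort-↭ xs = subst (_↭ xs) (sym (foldr-ins≗insertionSort xs)) (InsertionSort.sort-↭ xs)

  sort-↗ : ∀ xs → Sorted (foldr ins [] xs)
  sort-↗ xs = subst Sorted (sym (foldr-ins≗insertionSort xs)) (InsertionSort.sort-↗ xs)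

  ↗↭↗⇒≡ : ∀ {xs ys} → Sorted xs → Sorted ys → xs ↭ ys → xs ≡ ys
  ↗↭↗⇒≡ xs↗ ys↗ xs↭ys = ≋⇒≡ (↗↭↗⇒≋ totalOrder xs↗ ys↗ (↭⇒↭ₛ′ ≡-isEquivalence xs↭ys))

  sort-unique : ∀ {xs ys} → Sorted ys → xs ↭ ys → foldr ins [] xs ≡ ys
  sort-unique {xs} ys↗ xs↭ys = ↗↭↗⇒≡ (sort-↗ xs) ys↗ (↭-trans (sort-↭ xs) xs↭ys)

_≤ᶜ_ : Rel (ℕ × ℕ) 0ℓ
(a , b) ≤ᶜ (c , d) = a < c ⊎ (a ≡ c × d ≤ b)

≤ᶜ-trans : Transitive _≤ᶜ_
≤ᶜ-trans (inj₁ a<c)          (inj₁ c<e)          = inj₁ (<-trans a<c c<e)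
≤ᶜ-trans (inj₁ a<c)          (inj₂ (refl , _))   = inj₁ a<c
≤ᶜ-trans (inj₂ (refl , _))   (inj₁ c<e)          = inj₁ c<e
≤ᶜ-trans (inj₂ (refl , d≤b)) (inj₂ (refl , f≤d)) = inj₂ (refl , ≤-trans f≤d d≤b)

≤ᶜ-antisym : Antisymmetric _≡_ _≤ᶜ_
≤ᶜ-antisym (inj₁ a<c)          (inj₁ c<a)         = ⊥-elim (<-asym a<c c<a)
≤ᶜ-antisym (inj₁ a<c)          (inj₂ (refl , _))  = ⊥-elim (<-irrefl refl a<c)
≤ᶜ-antisym (inj₂ (refl , _))   (inj₁ c<a)         = ⊥-elim (<-irrefl refl c<a)
≤ᶜ-antisym (inj₂ (refl , d≤b)) (inj₂ (_ , b≤d))   = cong (_ ,_) (≤-antisym b≤d d≤b)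

≤ᶜ-total : Total _≤ᶜ_
≤ᶜ-total (a , b) (c , d) with <-cmp a c | ≤-total d b
... | tri< a<c _ _  | _        = inj₁ (inj₁ a<c)
... | tri> _ _ c<a  | _        = inj₂ (inj₁ c<a)
... | tri≈ _ refl _ | inj₁ d≤b = inj₁ (inj₂ (refl , d≤b))
... | tri≈ _ refl _ | inj₂ b≤d = inj₂ (inj₂ (refl , b≤d))

-- does (p ≤ᶜ? q) reduces to colLe p q (as does (m ≤? n) to m ≤ᵇ n), so insertCol and insertℕ
-- satisfy the defining equations of insertion sort by refl.
_≤ᶜ?_ : Decidable _≤ᶜ_
(a , b) ≤ᶜ? (c , d) = (a <? c) ⊎-dec ((a ≟ c) ×-dec (d ≤? b))

≤ᶜ-isDecTotalOrder : IsDecTotalOrder _≡_ _≤ᶜ_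
≤ᶜ-isDecTotalOrder = record
  { isTotalOrder = record
    { isPartialOrder = record
      { isPreorder = record
        { isEquivalence = isEquivalence
        ; reflexive     = λ { refl → inj₂ (refl , ≤-refl) }
        ; trans         = ≤ᶜ-trans
        }
      ; antisym = ≤ᶜ-antisym
      }
    ; total = ≤ᶜ-total
    }
  ; _≟_  = ≡-dec _≟_ _≟_
  ; _≤?_ = _≤ᶜ?_
  }

open FoldrInsertion ≤-isDecTotalOrder insertℕ (λ _ → refl) (λ _ _ _ → refl)
  using (Sorted; sort-unique)
open FoldrInsertion ≤ᶜ-isDecTotalOrder insertCol (λ _ → refl) (λ _ _ _ → refl)
  using () renaming (Sorted to Sortedᶜ; sort-↭ to sortCols-↭; sort-↗ to sortCols-↗; sort-unique to sortCols-unique)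

≤ᶜ⇒≤-proj₁ : ∀ {p q} → p ≤ᶜ q → proj₁ p ≤ proj₁ q
≤ᶜ⇒≤-proj₁ (inj₁ a<c)        = <⇒≤ a<c
≤ᶜ⇒≤-proj₁ (inj₂ (refl , _)) = ≤-refl

private
  variable
    A B : Set

map-proj₁-zip : ∀ (xs : List A) (ys : List B) → length xs ≡ length ys → map proj₁ (zip xs ys) ≡ xs
map-proj₁-zip []       []       _ = refl
map-proj₁-zip (x ∷ xs) (y ∷ ys) e = cong (x ∷_) (map-proj₁-zip xs ys (suc-injective e))

map-proj₂-zip : ∀ (xs : List A) (ys : List B) → length xs ≡ length ys → map proj₂ (zip xs ys) ≡ ys
map-proj₂-zip []       []       _ = refl
map-proj₂-zip (x ∷ xs) (y ∷ ys) e = cong (y ∷_) (map-proj₂-zip xs ys (suc-injective e))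

zip-map-proj₁-map-proj₂ : ∀ (ps : List (A × B)) → zip (map proj₁ ps) (map proj₂ ps) ≡ ps
zip-map-proj₁-map-proj₂ []       = refl
zip-map-proj₁-map-proj₂ (p ∷ ps) = cong (p ∷_) (zip-map-proj₁-map-proj₂ ps)

zip-applyUpTo : ∀ (f : ℕ → A) (g : ℕ → B) n →
                zip (applyUpTo f n) (applyUpTo g n) ≡ applyUpTo (λ i → f i , g i) n
zip-applyUpTo f g zero    = refl
zip-applyUpTo f g (suc n) = cong ((f 0 , g 0) ∷_) (zip-applyUpTo (f ∘ suc) (g ∘ suc) n)

applyUpTo-nth : ∀ xs → applyUpTo (λ i → nth xs (suc i)) (length xs) ≡ xs
applyUpTo-nth []       = refl
applyUpTo-nth (x ∷ xs) = cong (x ∷_) (applyUpTo-nth xs)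

idList-applyUpTo : ∀ n → idList n ≡ applyUpTo suc n
idList-applyUpTo n = map-applyUpTo (λ i → i) suc n

length-idList : ∀ n → length (idList n) ≡ n
length-idList n = trans (cong length (idList-applyUpTo n)) (length-applyUpTo suc n)

idList-↗ : ∀ n → Sorted (idList n)
idList-↗ n = subst Sorted (sym (idList-applyUpTo n)) (Linked.applyUpTo⁺₂ suc n (λ i → n≤1+n (suc i)))

sort-IsPerm : ∀ {π} → IsPerm π → sort π ≡ idList (length π)
sort-IsPerm π-perm = sort-unique (idList-↗ _) π-perm

transpose : List (ℕ × ℕ) → List (ℕ × ℕ)
transpose ps = sortCols (map swap ps)

Γ-transpose : ∀ u v → Γ u v ≡ map proj₂ (transpose (zip u v))
Γ-transpose u v = cong (map proj₂ ∘ sortCols) (sym (map-zipWith _,_ swap u v))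

map-proj₁-↗ : ∀ {ps} → Sortedᶜ ps → Sorted (map proj₁ ps)
map-proj₁-↗ = Linked.map⁺ ∘ Linked.map ≤ᶜ⇒≤-proj₁

transpose-↭ : ∀ ps → transpose ps ↭ map swap ps
transpose-↭ ps = sortCols-↭ (map swap ps)

map-proj₁-transpose : ∀ ps → map proj₁ (transpose ps) ≡ sort (map proj₂ ps)
map-proj₁-transpose ps = sym (sort-unique (map-proj₁-↗ (sortCols-↗ (map swap ps)))
  (↭-sym (↭-trans (map⁺ proj₁ (transpose-↭ ps)) (↭-reflexive (sym (map-∘ ps))))))

map-proj₂-transpose-↭ : ∀ ps → map proj₂ (transpose ps) ↭ map proj₁ ps
map-proj₂-transpose-↭ ps = ↭-trans (map⁺ proj₂ (transpose-↭ ps)) (↭-reflexive (sym (map-∘ ps)))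

transpose-involutive : ∀ {ps} → Sortedᶜ ps → transpose (transpose ps) ≡ ps
transpose-involutive {ps} ps↗ = sortCols-unique ps↗
  (↭-trans (map⁺ swap (transpose-↭ ps)) (↭-reflexive (trans (sym (map-∘ ps)) (map-id ps))))

module _ {u v : List ℕ} (|u|≡|v| : length u ≡ length v) where

  Γ-↭ : Γ u v ↭ u
  Γ-↭ = begin
    Γ u v                               ≡⟨ Γ-transpose u v ⟩
    map proj₂ (transpose (zip u v))     ↭⟨ map-proj₂-transpose-↭ (zip u v) ⟩
    map proj₁ (zip u v)                 ≡⟨ map-proj₁-zip u v |u|≡|v| ⟩
    u                                   ∎
    where open PermutationReasoning

  sort-Γ : Sortedᶜ (zip u v) → sort (Γ u v) ≡ u
  sort-Γ uv↗ = sort-unique (subst Sorted (map-proj₁-zip u v |u|≡|v|) (map-proj₁-↗ uv↗)) Γ-↭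

  Γ-sort-Γ : Sortedᶜ (zip u v) → Γ (sort v) (Γ u v) ≡ v
  Γ-sort-Γ uv↗ = begin
    Γ (sort v) (Γ u v)                            ≡⟨ cong₂ Γ sort-v (Γ-transpose u v) ⟩
    Γ (map proj₁ C) (map proj₂ C)                 ≡⟨ Γ-transpose (map proj₁ C) (map proj₂ C) ⟩
    map proj₂ (transpose (zip (map proj₁ C) (map proj₂ C)))
                                                  ≡⟨ cong (map proj₂ ∘ transpose) (zip-map-proj₁-map-proj₂ C) ⟩
    map proj₂ (transpose C)                       ≡⟨ cong (map proj₂) (transpose-involutive uv↗) ⟩
    map proj₂ (zip u v)                           ≡⟨ map-proj₂-zip u v |u|≡|v| ⟩
    v                                             ∎
    where
    open ≡-Reasoning
    C : List (ℕ × ℕ)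
    C = transpose (zip u v)
    sort-v : sort v ≡ map proj₁ C
    sort-v = trans (cong sort (sym (map-proj₂-zip u v |u|≡|v|))) (sym (map-proj₁-transpose (zip u v)))

maxL-↭ : ∀ {xs ys} → xs ↭ ys → maxL xs ≡ maxL ys
maxL-↭ p = foldr-commMonoid ⊔-0.setoid ⊔-0.isCommutativeMonoid (↭⇒↭ₛ p)
  where module ⊔-0 = CommutativeMonoid ⊔-0-commutativeMonoid

IsCay-resp-↭ : ∀ {xs ys} → xs ↭ ys → IsCay xs → IsCay ys
IsCay-resp-↭ p (positive , surjective) =
  All-resp-↭ p positive ,
  λ k 1≤k k≤max → ∈-resp-↭ p (surjective k 1≤k (subst (k ≤_) (sym (maxL-↭ p)) k≤max))

module UnitSteps (f : ℕ → ℕ) (f-suc : ∀ j → f (suc j) ≡ f j ⊎ f (suc j) ≡ suc (f j)) where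

  ≤-suc : ∀ j → f j ≤ f (suc j)
  ≤-suc j with f-suc j
  ... | inj₁ e = ≤-reflexive (sym e)
  ... | inj₂ e = ≤-trans (n≤1+n (f j)) (≤-reflexive (sym e))

  suc-≤ : ∀ j → f (suc j) ≤ suc (f j)
  suc-≤ j with f-suc j
  ... | inj₁ e = ≤-trans (≤-reflexive e) (n≤1+n (f j))
  ... | inj₂ e = ≤-reflexive e

  mono : ∀ {j k} → j ≤ k → f j ≤ f k
  mono {k = zero} z≤n = ≤-refl
  mono {k = suc k} j≤1+k with m≤n⇒m<n∨m≡n j≤1+k
  ... | inj₁ j<1+k = ≤-trans (mono (s≤s⁻¹ j<1+k)) (≤-suc k)
  ... | inj₂ refl  = ≤-refl

  intermediate : ∀ n {k} → f 0 ≤ k → k ≤ f n → ∃[ j ] (j ≤ n × f j ≡ k)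
  intermediate zero    f0≤k k≤f0 = zero , z≤n , ≤-antisym f0≤k k≤f0
  intermediate (suc n) {k} f0≤k k≤f1+n with k ≤? f n
  ... | yes k≤fn = let j , j≤n , fj≡k = intermediate n f0≤k k≤fn in j , m≤n⇒m≤1+n j≤n , fj≡k
  ... | no  k≰fn = suc n , ≤-refl , ≤-antisym (≤-trans (suc-≤ n) (≰⇒> k≰fn)) k≤f1+n

  IsCay-applyUpTo : f 0 ≡ 0 → f 1 ≡ 1 → ∀ n → IsCay (applyUpTo (f ∘ suc) n)
  IsCay-applyUpTo f0≡0 f1≡1 n = positive , surjective
    where
    positive : All (1 ≤_) (applyUpTo (f ∘ suc) n)
    positive = All.applyUpTo⁺₂ (f ∘ suc) n (λ i → subst (_≤ f (suc i)) f1≡1 (mono (s≤s z≤n)))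
    maxL≤fn : maxL (applyUpTo (f ∘ suc) n) ≤ f n
    maxL≤fn = foldr-preservesᵇ {P = _≤ f n} ⊔-lub z≤n (All.applyUpTo⁺₁ (f ∘ suc) n mono)
    surjective : ∀ k → 1 ≤ k → k ≤ maxL (applyUpTo (f ∘ suc) n) → k ∈ applyUpTo (f ∘ suc) n
    surjective k 1≤k k≤max with intermediate n (subst (_≤ k) (sym f0≡0) z≤n) (≤-trans k≤max maxL≤fn)
    ... | zero  , _     , refl = ⊥-elim (n≮0 (subst (1 ≤_) f0≡0 1≤k))
    ... | suc i , 1+i≤n , refl = ∈-applyUpTo⁺ (f ∘ suc) 1+i≤n

countActive-unitStep : ∀ π j →
  countActive π (suc j) ≡ countActive π j ⊎ countActive π (suc j) ≡ suc (countActive π j)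
countActive-unitStep π j with active π j
... | true  = inj₂ (+-comm _ 1)
... | false = inj₁ (+-identityʳ _)

upsilonTilde-applyUpTo : ∀ π → upsilonTilde π ≡ applyUpTo (countActive π ∘ suc) (length π)
upsilonTilde-applyUpTo π =
  trans (cong (map (countActive π)) (idList-applyUpTo (length π))) (map-applyUpTo suc (countActive π) (length π))

length-upsilonTilde : ∀ π → length (upsilonTilde π) ≡ length π
length-upsilonTilde π = trans (cong length (upsilonTilde-applyUpTo π)) (length-applyUpTo _ (length π))

upsilonTilde-IsCay : ∀ π → IsCay (upsilonTilde π)
upsilonTilde-IsCay π = subst IsCay (sym (upsilonTilde-applyUpTo π))
  (UnitSteps.IsCay-applyUpTo (countActive π) (countActive-unitStep π) refl refl (length π))

ascent⇒active : ∀ π {i} → suc i < length π → nth π (suc i) < nth π (suc (suc i)) → T (active π (suc i))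
ascent⇒active π i<n ascent =
  Equivalence.from T-∨ (inj₂ (Equivalence.from T-∧ (<⇒<ᵇ i<n , <⇒<ᵇ ascent)))

-- Only the ascent clause of η-activity matters here: an inactive site is a descent of π.
zip-upsilonTilde-↗ : ∀ π → Sortedᶜ (zip (upsilonTilde π) π)
zip-upsilonTilde-↗ π = subst Sortedᶜ (sym columns) (Linked.applyUpTo⁺₁ _ (length π) step)
  where
  P : ℕ → ℕ
  P i = nth π (suc i)
  columns : zip (upsilonTilde π) π ≡ applyUpTo (λ i → countActive π (suc i) , P i) (length π)
  columns = trans (cong₂ zip (upsilonTilde-applyUpTo π) (sym (applyUpTo-nth π))) (zip-applyUpTo _ _ _)
  step : ∀ {i} → suc i < length π → (countActive π (suc i) , P i) ≤ᶜ (countActive π (suc (suc i)) , P (suc i))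
  step {i} i<n with active π (suc i) in site
  ... | true  = inj₁ (m<m+n _ (s≤s z≤n))
  ... | false = inj₂ (sym (+-identityʳ _) , ≮⇒≥ (λ ascent → subst T site (ascent⇒active π i<n ascent)))

zip-idList-↗ : ∀ x → Sortedᶜ (zip (idList (length x)) x)
zip-idList-↗ x = subst Sortedᶜ (sym columns) (Linked.applyUpTo⁺₂ _ (length x) (λ i → inj₁ (n<1+n (suc i))))
  where
  columns : zip (idList (length x)) x ≡ applyUpTo (λ i → suc i , nth x (suc i)) (length x)
  columns = trans (cong₂ zip (idList-applyUpTo (length x)) (sym (applyUpTo-nth x))) (zip-applyUpTo _ _ _)

η-↭ : ∀ π → η π ↭ upsilonTilde π
η-↭ π = Γ-↭ (length-upsilonTilde π)

η-IsCay : ∀ π → IsCay (η π)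
η-IsCay π = IsCay-resp-↭ (↭-sym (η-↭ π)) (upsilonTilde-IsCay π)

sort-η : ∀ π → sort (η π) ≡ upsilonTilde π
sort-η π = sort-Γ (length-upsilonTilde π) (zip-upsilonTilde-↗ π)

γ-η : ∀ {π} → IsPerm π → γ (η π) ≡ π
γ-η {π} π-perm = begin
  Γ (idList (length (η π))) (η π) ≡⟨ cong (λ n → Γ (idList n) (η π)) |η|≡|π| ⟩
  Γ (idList (length π)) (η π)     ≡⟨ cong (λ u → Γ u (η π)) (sym (sort-IsPerm π-perm)) ⟩
  Γ (sort π) (η π)                ≡⟨ Γ-sort-Γ (length-upsilonTilde π) (zip-upsilonTilde-↗ π) ⟩
  π                               ∎
  where
  open ≡-Reasoning
  |η|≡|π| : length (η π) ≡ length π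
  |η|≡|π| = trans (↭-length (η-↭ π)) (length-upsilonTilde π)

upsilonTilde-γ-η : ∀ {π} → IsPerm π → upsilonTilde (γ (η π)) ≡ sort (η π)
upsilonTilde-γ-η {π} π-perm = trans (cong upsilonTilde (γ-η π-perm)) (sym (sort-η π))

γ-IsPerm : ∀ x → IsPerm (γ x)
γ-IsPerm x = subst (λ n → γ x ↭ idList n) (sym |γx|≡|x|) γx↭id
  where
  γx↭id : γ x ↭ idList (length x)
  γx↭id = Γ-↭ (length-idList (length x))
  |γx|≡|x| : length (γ x) ≡ length x
  |γx|≡|x| = trans (↭-length γx↭id) (length-idList (length x))

η-γ : ∀ x → upsilonTilde (γ x) ≡ sort x → η (γ x) ≡ x
η-γ x υ≡sort = trans (cong (λ u → Γ u (γ x)) υ≡sort)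
  (Γ-sort-Γ (length-idList (length x)) (zip-idList-↗ x))

mainTheorem19 : (x : List ℕ) →
    (∃[ π ] (IsPerm π × η π ≡ x)) ⇔ (IsCay x × upsilonTilde (γ x) ≡ sort x)
mainTheorem19 x = mk⇔
  (λ { (π , π-perm , refl) → η-IsCay π , upsilonTilde-γ-η π-perm })
  (λ (_ , υ≡sort) → γ x , γ-IsPerm x , η-γ x υ≡sort)
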